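{- Let $W$ be a recurrent infinite word which is periodic with period length $N$. Then the scale of every Rauzy scheme for $W$ is smaller than $N$.
   Context: $u\sqsubseteq w$: $u$ is a factor of $w$; $u\sqsubseteq_k w$: at least $k$ occurrences. $W$ recurrent: every factor occurs infinitely often; periodic with period length $N$: $W=uuu\cdots$ with $|u|=N$. A graph with words is a strongly connected directed multigraph each edge $e$ of which carries a front word $F(e)$ and a back word $B(e)$, every vertex being distributing (in-degree $1$, out-degree $>1$) or collecting (in-degree $>1$, out-degree $1$). Paths are sequences of consecutive edges with edge records (words over the edge set); a path is symmetric if its first edge starts at a collecting vertex and its last edge ends at a distributing vertex. For $s=v_1\dots v_n$: $F(s)$ = ordered concatenation of front words of $v_1$ and all $v_i$ starting at a distributing vertex; $B(s)$ = ordered concatenation of back words of all $v_i$ ending at a collecting vertex and of $v_n$. $S$ is a Rauzy scheme for $W$ if: (1) strongly connected, more than one edge; (2) front words of edges leaving one distributing vertex have pairwise distinct first letters, back words of edges entering one collecting vertex have pairwise distinct last letters; (3) $F(s)=B(s)$ for symmetric $s$; (4) for symmetric $s_1,s_2$, $F(s_1)\sqsubseteq_kF(s_2)$ implies the edge record of $s_1$ occurs at least $k$ times in that of $s_2$; (5) edge words are factors of $W$; (6) every factor of $W$ is a factor of $F(s)$ for some symmetric $s$; (7) for every edge $e$ there is a factor $u_e$ of $W$ such that every symmetric $s$ with $u_e\sqsubseteq F(s)$ passes through $e$. A support edge is an edge from a collecting to a distributing vertex. The scale of a scheme is the smallest length of the words written on its support edges. -}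

module Defs where

open import Data.Nat using (ℕ; _+_; _<_; _≤_)
open import Data.Bool using (Bool; if_then_else_)
open import Data.Fin using (Fin) renaming (_≟_ to _≟ᶠ_)
open import Data.List using (List; []; _∷_; _++_; _∷ʳ_; length; drop; map; upTo; filter; concatMap; allFin)
open import Data.List.NonEmpty using (List⁺; _∷_; head; last; toList)
open import Data.List.Membership.Propositional using (_∈_)
open import Data.List.Relation.Unary.All using (All)
open import Data.List.Relation.Unary.AllPairs using (AllPairs)
open import Data.List.Relation.Unary.Linked using (Linked)
open import Data.Product using (Σ; ∃; _×_; _,_)
open import Data.Sum using (_⊎_)
open import Relation.Nullary using (Dec; does; ¬_)
open import Relation.Nullary.Decidable using (_×-dec_)
open import Relation.Binary.PropositionalEquality using (_≡_; _≢_)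
import Data.Nat as ℕ

OccursAt : {A : Set} → List A → List A → ℕ → Set
OccursAt u w i = i ≤ length w × ∃ λ v → drop i w ≡ u ++ v

Factor : {A : Set} → List A → List A → Set
Factor u w = ∃ λ i → OccursAt u w i

AtLeastOcc : {A : Set} → ℕ → List A → List A → Set
AtLeastOcc k u w = Σ (List ℕ) λ is →
  length is ≡ k × AllPairs _<_ is × All (OccursAt u w) is

window : {A : Set} → (ℕ → A) → ℕ → ℕ → List A
window W i n = map (λ j → W (i + j)) (upTo n)

OccursAtW : {A : Set} → List A → (ℕ → A) → ℕ → Set
OccursAtW u W i = window W i (length u) ≡ u

FactorW : {A : Set} → List A → (ℕ → A) → Set
FactorW u W = ∃ λ i → OccursAtW u W i

Recurrent : {A : Set} → (ℕ → A) → Set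
Recurrent W = ∀ u → FactorW u W → ∀ m → ∃ λ i → m ≤ i × OccursAtW u W i

Periodic : {A : Set} → (ℕ → A) → ℕ → Set
Periodic W N = Σ (List _) λ u → 0 < N × length u ≡ N ×
  (∀ i → OccursAtW u W (i ℕ.* N))

record GraphData (A : Set) : Set where
  field
    nV  : ℕ
    nE  : ℕ
    src : Fin nE → Fin nV
    tgt : Fin nE → Fin nV
    F   : Fin nE → List A
    B   : Fin nE → List A

  indeg : Fin nV → ℕ
  indeg v = length (filter (λ e → tgt e ≟ᶠ v) (allFin nE))

  outdeg : Fin nV → ℕ
  outdeg v = length (filter (λ e → src e ≟ᶠ v) (allFin nE))

  Distributing : Fin nV → Set
  Distributing v = indeg v ≡ 1 × 1 < outdeg v

  Collecting : Fin nV → Set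
  Collecting v = 1 < indeg v × outdeg v ≡ 1

  distributing? : (v : Fin nV) → Dec (Distributing v)
  distributing? v = (indeg v ℕ.≟ 1) ×-dec (1 ℕ.<? outdeg v)

  collecting? : (v : Fin nV) → Dec (Collecting v)
  collecting? v = (1 ℕ.<? indeg v) ×-dec (outdeg v ℕ.≟ 1)

  -- paths: nonempty sequences of consecutive edges; the edge record
  -- of a path p is  toList p
  IsPath : List⁺ (Fin nE) → Set
  IsPath p = Linked (λ e f → tgt e ≡ src f) (toList p)

  Symmetric : List⁺ (Fin nE) → Set
  Symmetric p = IsPath p × Collecting (src (head p)) × Distributing (tgt (last p))

  StronglyConnected : Set
  StronglyConnected = ∀ v w → v ≡ w ⊎
    (Σ (List⁺ (Fin nE)) λ p → IsPath p × src (head p) ≡ v × tgt (last p) ≡ w)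

  Fpath : List⁺ (Fin nE) → List A
  Fpath (e ∷ es) = F e ++ concatMap
    (λ f → if does (distributing? (src f)) then F f else []) es

  Bpath′ : Fin nE → List (Fin nE) → List A
  Bpath′ e [] = B e
  Bpath′ e (f ∷ fs) = (if does (collecting? (tgt e)) then B e else []) ++ Bpath′ f fs

  Bpath : List⁺ (Fin nE) → List A
  Bpath (e ∷ es) = Bpath′ e es

  SupportEdge : Fin nE → Set
  SupportEdge e = Collecting (src e) × Distributing (tgt e)

  IsScale : ℕ → Set
  IsScale m = (∃ λ e → SupportEdge e × (length (F e) ≡ m ⊎ length (B e) ≡ m))
            × (∀ e → SupportEdge e → m ≤ length (F e) × m ≤ length (B e))

FirstLettersDiffer : {A : Set} → List A → List A → Set
FirstLettersDiffer u v = ∃ λ a → ∃ λ b → ∃ λ u′ → ∃ λ v′ →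
  u ≡ a ∷ u′ × v ≡ b ∷ v′ × a ≢ b

LastLettersDiffer : {A : Set} → List A → List A → Set
LastLettersDiffer u v = ∃ λ a → ∃ λ b → ∃ λ u′ → ∃ λ v′ →
  u ≡ u′ ∷ʳ a × v ≡ v′ ∷ʳ b × a ≢ b

record GraphWithWords (A : Set) : Set where
  field
    graph             : GraphData A
  open GraphData graph public
  field
    stronglyConnected : StronglyConnected
    vertexKind        : ∀ v → Distributing v ⊎ Collecting v

record IsRauzyScheme {A : Set} (W : ℕ → A) (S : GraphWithWords A) : Set where
  open GraphWithWords S
  field
    -- (1)
    connected   : StronglyConnected
    manyEdges   : 1 < nE
    -- (2)
    frontFirst  : ∀ e e′ → e ≢ e′ → src e ≡ src e′ → Distributing (src e) →
                  FirstLettersDiffer (F e) (F e′)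
    backLast    : ∀ e e′ → e ≢ e′ → tgt e ≡ tgt e′ → Collecting (tgt e) →
                  LastLettersDiffer (B e) (B e′)
    -- (3)
    symmetricFB : ∀ s → Symmetric s → Fpath s ≡ Bpath s
    -- (4)
    multiplicity : ∀ s₁ s₂ → Symmetric s₁ → Symmetric s₂ → ∀ k →
                  AtLeastOcc k (Fpath s₁) (Fpath s₂) →
                  AtLeastOcc k (toList s₁) (toList s₂)
    -- (5)
    edgeWords   : ∀ e → FactorW (F e) W × FactorW (B e) W
    -- (6)
    covering    : ∀ u → FactorW u W → ∃ λ s → Symmetric s × Factor u (Fpath s)
    -- (7)
    edgeMarker  : ∀ e → ∃ λ u → FactorW u W ×
                  (∀ s → Symmetric s → Factor u (Fpath s) → e ∈ toList s)

-- Suppose a support edge e carries a word w = F e with |w| ≥ N, occurring in W at p. The factor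
-- W[p, p + |w| + N) begins and ends with w, so it lies in the front word of a symmetric path, and
-- condition (4) forces every occurrence of w there to be induced by an occurrence of e. The two
-- occurrences of w, N letters apart, therefore cut out a cycle σ at e with front word
-- W[p + |w|, p + |w| + N). The front words of the paths e σʲ are the prefixes W[p, p + |w| + jN),
-- so by condition (7) every edge lies on one of them, and every edge g leaving the distributing
-- vertex tgt e follows an occurrence of w in W. As |w| ≥ N, periodicity makes the first letter of
-- F g the letter W (p + |w|), for all such g, contradicting condition (2).

module Submission where

open import Defs
open import Data.Nat using (ℕ; _<_)
open import Data.Product using (∃; _×_)

import Data.Nat.Properties as ℕ
open import Algebra.Properties.CommutativeSemigroup ℕ.+-commutativeSemigroup using (xy∙z≈xz∙y)
open import Data.Bool using (if_then_else_)
open import Data.Empty using (⊥; ⊥-elim)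
open import Data.Fin using (Fin) renaming (_≟_ to _≟ᶠ_)
open import Data.List
  using (List; []; _∷_; _++_; _∷ʳ_; length; drop; take; filter; concat; concatMap; replicate;
         applyUpTo; allFin; initLast; _∷ʳ′_)
open import Data.List.Extrema.Nat using (argmin; argmin-all; f[argmin]≤f[xs])
open import Data.List.Membership.DecPropositional ℕ._≟_ using (_∈?_)
open import Data.List.Membership.Propositional using (_∈_)
open import Data.List.Membership.Propositional.Properties using (∈-filter⁺; ∈-allFin; ∈-∃++)
open import Data.List.NonEmpty using (_∷_; last)
import Data.List.Properties as List
open import Data.List.Relation.Unary.All as All using (All; []; _∷_)
open import Data.List.Relation.Unary.All.Properties using (all-filter)
open import Data.List.Relation.Unary.AllPairs using (AllPairs; []; _∷_)
open import Data.List.Relation.Unary.Any using (here; there)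
open import Data.List.Relation.Unary.Linked using (Linked; [-]; _∷_)
import Data.List.Relation.Unary.Unique.Propositional.Properties as Unique
open import Data.Nat using (zero; suc; _+_; _*_; _∸_; _≤_; z≤n; s≤s; z<s; >-nonZero)
open import Data.Nat.DivMod using (_%_; _/_; m≡m%n+[m/n]*n; m%n<n)
open import Data.Product using (_,_; proj₁; proj₂; ∃₂)
open import Data.Sum using (_⊎_; inj₁; inj₂)
open import Function using (_∘_)
open import Relation.Binary.PropositionalEquality
open import Relation.Nullary using (¬_; Dec; yes; no; does)
open import Relation.Nullary.Decidable using (dec-true; _×-dec_)

private
  variable
    X : Set

lastFrom : X → List X → X
lastFrom x []       = x
lastFrom x (y ∷ ys) = lastFrom y ys

lastFrom-++ : (x : X) (xs ys : List X) → lastFrom x (xs ++ ys) ≡ lastFrom (lastFrom x xs) ys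
lastFrom-++ x []       ys = refl
lastFrom-++ x (y ∷ xs) ys = lastFrom-++ y xs ys

last≡lastFrom : (x : X) (xs : List X) → last (x ∷ xs) ≡ lastFrom x xs
last≡lastFrom x xs with initLast xs
... | []      = refl
... | ys ∷ʳ′ y = sym (lastFrom-++ x ys (y ∷ []))

module _ {R : X → X → Set} where

  Linked-prefix : ∀ x xs ys → Linked R (x ∷ xs ++ ys) → Linked R (x ∷ xs)
  Linked-prefix x []       ys _         = [-]
  Linked-prefix x (y ∷ xs) ys (r ∷ rs) = r ∷ Linked-prefix y xs ys rs

  Linked-suffix : ∀ x xs ys → Linked R (x ∷ xs ++ ys) → Linked R (lastFrom x xs ∷ ys)
  Linked-suffix x []       ys rs       = rs
  Linked-suffix x (y ∷ xs) ys (_ ∷ rs) = Linked-suffix y xs ys rs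

  Linked-++ : ∀ x xs ys → Linked R (x ∷ xs) → Linked R (lastFrom x xs ∷ ys) → Linked R (x ∷ xs ++ ys)
  Linked-++ x []       ys _        rs = rs
  Linked-++ x (y ∷ xs) ys (r ∷ rs) ss = r ∷ Linked-++ y xs ys rs ss

++-prefix-total : (as bs cs ds : List X) → as ++ bs ≡ cs ++ ds →
                  (∃ λ σ → cs ≡ as ++ σ) ⊎ (∃ λ τ → as ≡ cs ++ τ)
++-prefix-total []       bs cs       ds eq = inj₁ (cs , refl)
++-prefix-total (a ∷ as) bs []       ds eq = inj₂ (a ∷ as , refl)
++-prefix-total (a ∷ as) bs (c ∷ cs) ds eq with List.∷-injective eq
... | refl , eq′ with ++-prefix-total as bs cs ds eq′
...   | inj₁ (σ , p) = inj₁ (σ , cong (a ∷_) p)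
...   | inj₂ (τ , p) = inj₂ (τ , cong (a ∷_) p)

++-cancel-length : (as bs cs ds : List X) → length as ≡ length cs → as ++ bs ≡ cs ++ ds →
                   as ≡ cs × bs ≡ ds
++-cancel-length []       bs []       ds _ eq = refl , eq
++-cancel-length (a ∷ as) bs (c ∷ cs) ds l eq with List.∷-injective eq
... | refl , eq′ with ++-cancel-length as bs cs ds (ℕ.suc-injective l) eq′
...   | refl , q = refl , q

OccursAt-++ : (P u v : List X) → OccursAt u (P ++ u ++ v) (length P)
OccursAt-++ []      u v = z≤n , v , refl
OccursAt-++ (x ∷ P) u v with OccursAt-++ P u v
... | le , rest = s≤s le , rest

OccursAt⇒++ : ∀ {u w : List X} {i} → OccursAt u w i → ∃₂ λ P v → w ≡ P ++ u ++ v × length P ≡ i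
OccursAt⇒++ {w = w} {i} (i≤ , v , eq) =
  take i w , v ,
  trans (sym (List.take++drop≡id i w)) (cong (take i w ++_) eq) ,
  trans (List.length-take i w) (ℕ.m≤n⇒m⊓n≡m i≤)

count : ∀ {n} → Fin n → List (Fin n) → ℕ
count e xs = length (filter (_≟ᶠ e) xs)

drop-∷ : ∀ i (xs : List X) {y v} → drop i xs ≡ y ∷ v → drop (suc i) xs ≡ v
drop-∷ zero    (x ∷ xs) refl = refl
drop-∷ (suc i) (x ∷ xs) eq   = drop-∷ i xs eq

count-drop : ∀ {n} (e : Fin n) k xs → count e (drop k xs) ≤ count e xs
count-drop e zero    xs       = ℕ.≤-refl
count-drop e (suc k) []       = z≤n
count-drop e (suc k) (x ∷ xs) with x ≟ᶠ e
... | yes _ = ℕ.m≤n⇒m≤1+n (count-drop e k xs)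
... | no  _ = count-drop e k xs

count-drop-mono : ∀ {n} (e : Fin n) {m i} xs → m ≤ i → count e (drop i xs) ≤ count e (drop m xs)
count-drop-mono e {i = i} xs       z≤n       = count-drop e i xs
count-drop-mono e         []       (s≤s _)   = z≤n
count-drop-mono e         (x ∷ xs) (s≤s m≤i) = count-drop-mono e xs m≤i

occurrences≤count : ∀ {n} (e : Fin n) xs k → AtLeastOcc k (e ∷ []) xs → k ≤ count e xs
occurrences≤count e xs k (is , refl , sorted , occs) = bounded 0 is (All.tabulate λ _ → z≤n) sorted occs
  where
    bounded : ∀ m is → All (m ≤_) is → AllPairs _<_ is → All (OccursAt (e ∷ []) xs) is →
              length is ≤ count e (drop m xs)
    bounded m []       _         _               _                   = z≤n
    bounded m (i ∷ is) (m≤i ∷ _) (i<is ∷ sorted) ((_ , v , at) ∷ occs) = begin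
      suc (length is)                 ≤⟨ s≤s (bounded (suc i) is i<is sorted occs) ⟩
      suc (count e (drop (suc i) xs)) ≡⟨ cong (λ ys → suc (count e ys)) (drop-∷ i xs at) ⟩
      suc (count e v)                 ≡⟨ cong length (List.filter-accept (_≟ᶠ e) refl) ⟨
      count e (e ∷ v)                 ≡⟨ cong (count e) at ⟨
      count e (drop i xs)             ≤⟨ count-drop-mono e xs m≤i ⟩
      count e (drop m xs)             ∎
      where open ℕ.≤-Reasoning

insert : ℕ → List ℕ → List ℕ
insert x []       = x ∷ []
insert x (q ∷ qs) with x ℕ.<? q
... | yes _ = x ∷ q ∷ qs
... | no  _ = q ∷ insert x qs

length-insert : ∀ x qs → length (insert x qs) ≡ suc (length qs)
length-insert x []       = refl
length-insert x (q ∷ qs) with x ℕ.<? q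
... | yes _ = refl
... | no  _ = cong suc (length-insert x qs)

All-insert : ∀ {P : ℕ → Set} x qs → P x → All P qs → All P (insert x qs)
All-insert x []       px []         = px ∷ []
All-insert x (q ∷ qs) px (pq ∷ pqs) with x ℕ.<? q
... | yes _ = px ∷ pq ∷ pqs
... | no  _ = pq ∷ All-insert x qs px pqs

AllPairs-insert : ∀ x qs → ¬ x ∈ qs → AllPairs _<_ qs → AllPairs _<_ (insert x qs)
AllPairs-insert x []       _   _          = [] ∷ []
AllPairs-insert x (q ∷ qs) x∉ (q<qs ∷ qs<) with x ℕ.<? q
... | yes x<q = (x<q ∷ All.map (ℕ.<-trans x<q) q<qs) ∷ q<qs ∷ qs<
... | no  x≮q = All-insert x qs q<x q<qs ∷ AllPairs-insert x qs (x∉ ∘ there) qs<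
  where q<x = ℕ.≤∧≢⇒< (ℕ.≮⇒≥ x≮q) (λ q≡x → x∉ (here (sym q≡x)))

module Segments {A : Set} (W : ℕ → A) where

  segment : ℕ → ℕ → List A
  segment i zero    = []
  segment i (suc n) = W i ∷ segment (suc i) n

  length-segment : ∀ i n → length (segment i n) ≡ n
  length-segment i zero    = refl
  length-segment i (suc n) = cong suc (length-segment (suc i) n)

  segment-+ : ∀ i m n → segment i (m + n) ≡ segment i m ++ segment (i + m) n
  segment-+ i zero    n rewrite ℕ.+-identityʳ i = refl
  segment-+ i (suc m) n rewrite ℕ.+-suc i m = cong (W i ∷_) (segment-+ (suc i) m n)

  segment-cong : ∀ i k n → (∀ j → W (i + j) ≡ W (k + j)) → segment i n ≡ segment k n
  segment-cong i k zero    _ = refl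
  segment-cong i k (suc n) h = cong₂ _∷_
    (subst₂ (λ a b → W a ≡ W b) (ℕ.+-identityʳ i) (ℕ.+-identityʳ k) (h 0))
    (segment-cong (suc i) (suc k) n λ j →
      subst₂ (λ a b → W a ≡ W b) (ℕ.+-suc i j) (ℕ.+-suc k j) (h (suc j)))

  segment-≡⇒W≡ : ∀ i k n → segment i n ≡ segment k n → ∀ j → j < n → W (i + j) ≡ W (k + j)
  segment-≡⇒W≡ i k (suc n) eq zero    _ rewrite ℕ.+-identityʳ i | ℕ.+-identityʳ k =
    List.∷-injectiveˡ eq
  segment-≡⇒W≡ i k (suc n) eq (suc j) (s≤s j<n) rewrite ℕ.+-suc i j | ℕ.+-suc k j =
    segment-≡⇒W≡ (suc i) (suc k) n (List.∷-injectiveʳ eq) j j<n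

  segment-++⁻ : ∀ i n (P Q : List A) → segment i n ≡ P ++ Q →
                segment i (length P) ≡ P × segment (i + length P) (length Q) ≡ Q
  segment-++⁻ i n P Q eq = ++-cancel-length _ _ P Q (length-segment i (length P)) (begin
    segment i (length P) ++ segment (i + length P) (length Q) ≡⟨ segment-+ i (length P) (length Q) ⟨
    segment i (length P + length Q)                         ≡⟨ cong (segment i) (List.length-++ P) ⟨
    segment i (length (P ++ Q))                             ≡⟨ cong (λ R → segment i (length R)) eq ⟨
    segment i (length (segment i n))                        ≡⟨ cong (segment i) (length-segment i n) ⟩
    segment i n                                             ≡⟨ eq ⟩
    P ++ Q                                                  ∎)
    where open ≡-Reasoning

  segment-factor : ∀ i d m n → d + m ≤ n → Factor (segment (i + d) m) (segment i n)
  segment-factor i d m n d+m≤n with ℕ.m≤n⇒∃[o]m+o≡n d+m≤n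
  ... | k , refl = d , subst₂ (OccursAt (segment (i + d) m)) (sym split) (length-segment i d)
                     (OccursAt-++ (segment i d) (segment (i + d) m) (segment (i + d + m) k))
    where
      split : segment i (d + m + k) ≡ segment i d ++ segment (i + d) m ++ segment (i + d + m) k
      split = begin
        segment i (d + m + k)                                       ≡⟨ cong (segment i) (ℕ.+-assoc d m k) ⟩
        segment i (d + (m + k))                                     ≡⟨ segment-+ i d (m + k) ⟩
        segment i d ++ segment (i + d) (m + k)                      ≡⟨ cong (segment i d ++_) (segment-+ (i + d) m k) ⟩
        segment i d ++ segment (i + d) m ++ segment (i + d + m) k   ∎
        where open ≡-Reasoning

  window≡segment : ∀ i n → window W i n ≡ segment i n
  window≡segment i n = trans (List.map-upTo (λ j → W (i + j)) n) (applyUpTo≡segment n i _ (λ _ → refl))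
    where
      applyUpTo≡segment : ∀ n i f → (∀ j → f j ≡ W (i + j)) → applyUpTo f n ≡ segment i n
      applyUpTo≡segment zero    i f h = refl
      applyUpTo≡segment (suc n) i f h = cong₂ _∷_
        (trans (h 0) (cong W (ℕ.+-identityʳ i)))
        (applyUpTo≡segment n (suc i) (f ∘ suc) λ j → trans (h (suc j)) (cong W (ℕ.+-suc i j)))

module PeriodicWord {A : Set} (W : ℕ → A) (N : ℕ) (period : ∀ k → W (k + N) ≡ W k) where
  open Segments W

  segment-+N : ∀ i n → segment (i + N) n ≡ segment i n
  segment-+N i n = segment-cong (i + N) i n λ j →
    trans (cong W (xy∙z≈xz∙y i N j)) (period (i + j))

  segment-borders : ∀ p (w : List A) → segment p (length w) ≡ w →
                    segment p (length w + N) ≡ w ++ segment (p + length w) N ×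
                    segment p (length w + N) ≡ segment p N ++ w
  segment-borders p w w-at-p =
    trans (segment-+ p (length w) N) (cong (_++ segment (p + length w) N) w-at-p) ,
    (begin
      segment p (length w + N)               ≡⟨ cong (segment p) (ℕ.+-comm (length w) N) ⟩
      segment p (N + length w)               ≡⟨ segment-+ p N (length w) ⟩
      segment p N ++ segment (p + N) (length w) ≡⟨ cong (segment p N ++_) (trans (segment-+N p (length w)) w-at-p) ⟩
      segment p N ++ w                       ∎)
    where open ≡-Reasoning

  concat-replicate-segment : ∀ i j → concat (replicate j (segment i N)) ≡ segment i (j * N)
  concat-replicate-segment i zero    = refl
  concat-replicate-segment i (suc j) = begin
    segment i N ++ concat (replicate j (segment i N)) ≡⟨ cong (segment i N ++_) (concat-replicate-segment i j) ⟩
    segment i N ++ segment i (j * N)                  ≡⟨ cong (segment i N ++_) (segment-+N i (j * N)) ⟨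
    segment i N ++ segment (i + N) (j * N)            ≡⟨ segment-+ i N (j * N) ⟨
    segment i (N + j * N)                             ∎
    where open ≡-Reasoning

  -- Once |w| ≥ N, periodicity lets the letter after w be read inside w itself.
  letter-after : ∀ (w : List A) p q → 0 < N → N ≤ length w → segment p (length w) ≡ w → segment q (length w) ≡ w →
                 W (q + length w) ≡ W (p + length w)
  letter-after w p q N>0 N≤ wp wq = begin
    W (q + length w)   ≡⟨ cong (λ n → W (q + n)) (sym t+N) ⟩
    W (q + (t + N))    ≡⟨ cong W (ℕ.+-assoc q t N) ⟨
    W (q + t + N)      ≡⟨ period (q + t) ⟩
    W (q + t)          ≡⟨ segment-≡⇒W≡ q p (length w) (trans wq (sym wp)) t t< ⟩
    W (p + t)          ≡⟨ period (p + t) ⟨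
    W (p + t + N)      ≡⟨ cong W (ℕ.+-assoc p t N) ⟩
    W (p + (t + N))    ≡⟨ cong (λ n → W (p + n)) t+N ⟩
    W (p + length w)   ∎
    where
      open ≡-Reasoning
      t = length w ∸ N
      t+N : t + N ≡ length w
      t+N = ℕ.m∸n+n≡m N≤
      t< : t < length w
      t< = ℕ.∸-monoʳ-< N>0 N≤

periodic⇒period : ∀ {A : Set} (W : ℕ → A) N → Periodic W N → ∀ k → W (k + N) ≡ W k
periodic⇒period W N (u , N>0 , |u|≡N , occ) k = begin
  W (k + N)              ≡⟨ cong (λ n → W (n + N)) k≡ ⟩
  W (q * N + r + N)      ≡⟨ cong W (trans (ℕ.+-comm (q * N + r) N) (sym (ℕ.+-assoc N (q * N) r))) ⟩
  W (suc q * N + r)      ≡⟨ aligned (suc q) ⟩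
  W r                    ≡⟨ aligned q ⟨
  W (q * N + r)          ≡⟨ cong W k≡ ⟨
  W k                    ∎
  where
    open ≡-Reasoning
    open Segments W
    instance _ = >-nonZero N>0
    r = k % N
    q = k / N
    k≡ : k ≡ q * N + r
    k≡ = trans (m≡m%n+[m/n]*n k N) (ℕ.+-comm r (q * N))
    block : ∀ i → segment (i * N) N ≡ u
    block i = trans (sym (window≡segment (i * N) N)) (subst (λ n → window W (i * N) n ≡ u) |u|≡N (occ i))
    aligned : ∀ i → W (i * N + r) ≡ W r
    aligned i = segment-≡⇒W≡ (i * N) 0 N (trans (block i) (sym (block 0))) r (m%n<n k N)

∈-singleton-unique : ∀ {xs : List X} {a b} → length xs ≡ 1 → a ∈ xs → b ∈ xs → a ≡ b
∈-singleton-unique {xs = _ ∷ []} _ (here refl) (here refl) = refl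

two-distinct : ∀ {P : X → Set} xs → 1 < length xs → AllPairs _≢_ xs → All P xs →
               ∃₂ λ a b → a ≢ b × P a × P b
two-distinct (a ∷ b ∷ _) _         ((a≢b ∷ _) ∷ _) (pa ∷ pb ∷ _) = a , b , a≢b , pa , pb
two-distinct (_ ∷ [])    (s≤s ()) _               _

module GraphLemmas {A : Set} (S : GraphWithWords A) where
  open GraphWithWords S

  Step : Fin nE → Fin nE → Set
  Step e f = tgt e ≡ src f

  frontTail : List (Fin nE) → List A
  frontTail = concatMap (λ f → if does (distributing? (src f)) then F f else [])

  distributing⇒¬collecting : ∀ {v} → Distributing v → ¬ Collecting v
  distributing⇒¬collecting (in≡1 , _) (1<in , _) = ℕ.<-irrefl (sym in≡1) 1<in

  distributing-in-unique : ∀ {v a b} → Distributing v → tgt a ≡ v → tgt b ≡ v → a ≡ b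
  distributing-in-unique {v} {a} {b} (in≡1 , _) ta tb = ∈-singleton-unique in≡1
    (∈-filter⁺ (λ e → tgt e ≟ᶠ v) (∈-allFin a) ta)
    (∈-filter⁺ (λ e → tgt e ≟ᶠ v) (∈-allFin b) tb)

  distributing-two-out : ∀ {v} → Distributing v → ∃₂ λ g g′ → g ≢ g′ × src g ≡ v × src g′ ≡ v
  distributing-two-out {v} (_ , 1<out) = two-distinct _ 1<out
    (Unique.filter⁺ (λ e → src e ≟ᶠ v) (Unique.allFin⁺ nE))
    (all-filter (λ e → src e ≟ᶠ v) (allFin nE))

  frontTail-++ : ∀ xs ys → frontTail (xs ++ ys) ≡ frontTail xs ++ frontTail ys
  frontTail-++ = List.concatMap-++ _

  frontTail-∷ : ∀ {g} γ → Distributing (src g) → frontTail (g ∷ γ) ≡ F g ++ frontTail γ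
  frontTail-∷ {g} γ d = cong (λ b → (if b then F g else []) ++ frontTail γ) (dec-true (distributing? (src g)) d)

  frontTail-replicate : ∀ σ j → frontTail (concat (replicate j σ)) ≡ concat (replicate j (frontTail σ))
  frontTail-replicate σ zero    = refl
  frontTail-replicate σ (suc j) = trans (frontTail-++ σ _) (cong (frontTail σ ++_) (frontTail-replicate σ j))

  Fpath-++ : ∀ x β γ → Fpath (x ∷ β ++ γ) ≡ Fpath (x ∷ β) ++ frontTail γ
  Fpath-++ x β γ = trans (cong (F x ++_) (frontTail-++ β γ)) (sym (List.++-assoc (F x) _ _))

  length-Fpath-++ : ∀ x β γ → length (Fpath (x ∷ β ++ γ)) ≡ length (Fpath (x ∷ β)) + length (frontTail γ)
  length-Fpath-++ x β γ = trans (cong length (Fpath-++ x β γ)) (List.length-++ (Fpath (x ∷ β)))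

  Bpath′-ends : ∀ x xs → ∃ λ P → Bpath′ x xs ≡ P ++ B (lastFrom x xs)
  Bpath′-ends x []       = [] , refl
  Bpath′-ends x (y ∷ ys) with Bpath′-ends y ys
  ... | P , eq = Bx ++ P , trans (cong (Bx ++_) eq) (sym (List.++-assoc Bx P _))
    where Bx = if does (collecting? (tgt x)) then B x else []

  Cycle : Fin nE → List (Fin nE) → Set
  Cycle e σ = Linked Step (e ∷ σ) × lastFrom e σ ≡ e

  Cycle-replicate : ∀ {e σ} → Cycle e σ → ∀ j → Cycle e (concat (replicate j σ))
  Cycle-replicate c zero = [-] , refl
  Cycle-replicate {e} {σ} c@(path , ends) (suc j) with Cycle-replicate c j
  ... | path′ , ends′ =
    Linked-++ e σ ρ path (subst (λ y → Linked Step (y ∷ ρ)) (sym ends) path′) ,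
    trans (lastFrom-++ e σ ρ) (trans (cong (λ y → lastFrom y ρ) ends) ends′)
    where ρ = concat (replicate j σ)

  symmetric : ∀ {x xs} → Linked Step (x ∷ xs) → Collecting (src x) → Distributing (tgt (lastFrom x xs)) →
              Symmetric (x ∷ xs)
  symmetric {x} {xs} path c d = path , c , subst (Distributing ∘ tgt) (sym (last≡lastFrom x xs)) d

module RauzyScheme {A : Set} {W : ℕ → A} {S : GraphWithWords A} (R : IsRauzyScheme W S) where
  open GraphWithWords S
  open IsRauzyScheme R
  open GraphLemmas S

  F≡B : ∀ {e} → SupportEdge e → F e ≡ B e
  F≡B {e} (c , d) = trans (sym (List.++-identityʳ (F e))) (symmetricFB (e ∷ []) ([-] , c , d))

  F-nonempty : ∀ {g} → Distributing (src g) → ∃₂ λ a w → F g ≡ a ∷ w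
  F-nonempty {g} d with distributing-two-out d
  ... | g₁ , g₂ , g₁≢g₂ , s₁ , s₂ with g ≟ᶠ g₁
  ...   | no g≢g₁ = let a , _ , w , _ , Fg≡ , _ = frontFirst g g₁ g≢g₁ (sym s₁) d in a , w , Fg≡
  ...   | yes refl = let a , _ , w , _ , Fg≡ , _ = frontFirst g g₂ g₁≢g₂ (sym s₂) d in a , w , Fg≡

  Fpath-ends-at-support : ∀ {e x xs} → SupportEdge e → Linked Step (x ∷ xs) → Collecting (src x) →
                          lastFrom x xs ≡ e → ∃ λ P → Fpath (x ∷ xs) ≡ P ++ F e
  Fpath-ends-at-support {x = x} {xs} se@(_ , d) path c refl with Bpath′-ends x xs
  ... | P , eq = P , (begin
    Fpath (x ∷ xs)         ≡⟨ symmetricFB (x ∷ xs) (symmetric path c d) ⟩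
    Bpath′ x xs            ≡⟨ eq ⟩
    P ++ B (lastFrom x xs) ≡⟨ cong (P ++_) (F≡B se) ⟨
    P ++ F (lastFrom x xs) ∎)
    where open ≡-Reasoning

  Fpath-through-support : ∀ {e g x xs} → SupportEdge e → Symmetric (x ∷ xs) → g ∈ x ∷ xs → src g ≡ tgt e →
                          ∃₂ λ P Q → Fpath (x ∷ xs) ≡ P ++ F e ++ F g ++ Q
  Fpath-through-support {e} {g} se@(_ , d) (path , c , _) g∈ sg≡te with ∈-∃++ g∈
  ... | [] , _ , refl = ⊥-elim (distributing⇒¬collecting (subst Distributing (sym sg≡te) d) c)
  ... | x ∷ ys , zs , refl with Linked-suffix x ys (g ∷ zs) path
  ...   | step ∷ _ with Fpath-ends-at-support se (Linked-prefix x ys (g ∷ zs) path) c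
                          (distributing-in-unique d (trans step sg≡te) refl)
  ...     | P , eq = P , frontTail zs , (begin
    Fpath (x ∷ ys ++ g ∷ zs)             ≡⟨ Fpath-++ x ys (g ∷ zs) ⟩
    Fpath (x ∷ ys) ++ frontTail (g ∷ zs) ≡⟨ cong₂ _++_ eq (frontTail-∷ zs (subst Distributing (sym sg≡te) d)) ⟩
    (P ++ F e) ++ F g ++ frontTail zs    ≡⟨ List.++-assoc P (F e) _ ⟩
    P ++ F e ++ F g ++ frontTail zs      ∎)
    where open ≡-Reasoning

  support-edge-exists : ∃ SupportEdge
  support-edge-exists with covering [] (0 , refl)
  ... | x ∷ xs , (path , c , d) , _ = walk x xs path c (subst (Distributing ∘ tgt) (last≡lastFrom x xs) d)
    where
      walk : ∀ x xs → Linked Step (x ∷ xs) → Collecting (src x) → Distributing (tgt (lastFrom x xs)) →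
             ∃ SupportEdge
      walk x []       _             c d = x , c , d
      walk x (y ∷ ys) (step ∷ path) c d with vertexKind (tgt x)
      ... | inj₁ dx = x , c , dx
      ... | inj₂ cx = walk y ys path (subst Collecting step cx) d

  scale-attained : ∃ λ e → SupportEdge e × IsScale (length (F e))
  scale-attained = m , sm , (m , sm , inj₁ refl) , λ e se →
    minimal e se , subst (length (F m) ≤_) (cong length (F≡B se)) (minimal e se)
    where
      support? : ∀ e → Dec (SupportEdge e)
      support? e = collecting? (src e) ×-dec distributing? (tgt e)
      e₀ = proj₁ support-edge-exists
      supportEdges = filter support? (allFin nE)
      m = argmin (length ∘ F) e₀ supportEdges
      sm : SupportEdge m
      sm = argmin-all (length ∘ F) (proj₂ support-edge-exists) (all-filter support? (allFin nE))
      minimal : ∀ e → SupportEdge e → length (F m) ≤ length (F e)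
      minimal e se = All.lookup (f[argmin]≤f[xs] e₀ supportEdges) (∈-filter⁺ support? (∈-allFin e) se)

  Fpath-grows : ∀ x pre {g} β → Distributing (src g) →
                length (Fpath (x ∷ pre)) < length (Fpath (x ∷ pre ++ g ∷ β))
  Fpath-grows x pre {g} β d with F-nonempty d
  ... | a , w , Fg≡ = begin-strict
    length (Fpath (x ∷ pre))                                 <⟨ ℕ.m<m+n _ z<s ⟩
    length (Fpath (x ∷ pre)) + length (a ∷ w ++ frontTail β) ≡⟨ cong (λ u → length (Fpath (x ∷ pre)) + length u) tail≡ ⟨
    length (Fpath (x ∷ pre)) + length (frontTail (g ∷ β))    ≡⟨ length-Fpath-++ x pre (g ∷ β) ⟨
    length (Fpath (x ∷ pre ++ g ∷ β))                        ∎
    where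
      open ℕ.≤-Reasoning
      tail≡ : frontTail (g ∷ β) ≡ a ∷ w ++ frontTail β
      tail≡ = trans (frontTail-∷ β d) (cong (_++ frontTail β) Fg≡)

  module SupportOccurrences {e} (se : SupportEdge e) {x xs} (symmetric-x∷xs : Symmetric (x ∷ xs)) where

    along : ∀ {ys} → xs ≡ ys → Linked Step (x ∷ ys)
    along eq = subst (Linked Step ∘ (x ∷_)) eq (proj₁ symmetric-x∷xs)

    prefix-Fpath-ends : ∀ π rest → xs ≡ π ++ rest → lastFrom x π ≡ e → ∃ λ P → Fpath (x ∷ π) ≡ P ++ F e
    prefix-Fpath-ends π rest split =
      Fpath-ends-at-support se (Linked-prefix x π rest (along split)) (proj₁ (proj₂ symmetric-x∷xs))

    -- An occurrence of e in the path ending the prefix π, with π extending pre, together with the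
    -- start q of the occurrence of F e that it induces in the front word.
    record InducedAt (pre : List (Fin nE)) (q : ℕ) : Set where
      constructor induced
      field
        π rest   : List (Fin nE)
        extends  : ∃ λ ext → π ≡ pre ++ ext
        split    : xs ≡ π ++ rest
        ends     : lastFrom x π ≡ e
        position : q + length (F e) ≡ length (Fpath (x ∷ π))

    induced-here : ∀ pre rest → xs ≡ pre ++ rest → lastFrom x pre ≡ e →
                   ∃ λ q → InducedAt pre q × q + length (F e) ≡ length (Fpath (x ∷ pre))
    induced-here pre rest split ends with prefix-Fpath-ends pre rest split ends
    ... | P , eq = length P , induced pre rest ([] , sym (List.++-identityʳ pre)) split ends position , position
      where position = trans (sym (List.length-++ P)) (cong length (sym eq))

    induced-weaken : ∀ {pre b q} → InducedAt (pre ∷ʳ b) q → InducedAt pre q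
    induced-weaken {pre} {b} (induced π rest (ext , refl) split ends position) =
      induced π rest (b ∷ ext , List.∷ʳ-++ pre b ext) split ends position

    induced-beyond : ∀ {pre b q₀ q} → lastFrom x pre ≡ e → q₀ + length (F e) ≡ length (Fpath (x ∷ pre)) →
                     InducedAt (pre ∷ʳ b) q → q₀ < q
    induced-beyond {pre} {b} {q₀} {q} le at₀ (induced _ rest (ext , refl) split _ position) =
      ℕ.+-cancelʳ-< (length (F e)) q₀ q (begin-strict
        q₀ + length (F e)                     ≡⟨ at₀ ⟩
        length (Fpath (x ∷ pre))              <⟨ Fpath-grows x pre ext (subst Distributing step (proj₂ se)) ⟩
        length (Fpath (x ∷ pre ++ b ∷ ext))   ≡⟨ cong (λ π → length (Fpath (x ∷ π))) (List.∷ʳ-++ pre b ext) ⟨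
        length (Fpath (x ∷ (pre ∷ʳ b) ++ ext)) ≡⟨ position ⟨
        q + length (F e)                      ∎)
      where
        open ℕ.≤-Reasoning
        step : tgt e ≡ src b
        step with Linked-suffix x pre (b ∷ ext ++ rest)
                    (along (trans split (trans (List.++-assoc (pre ∷ʳ b) ext rest) (List.∷ʳ-++ pre b (ext ++ rest)))))
        ... | s ∷ _ = trans (cong tgt (sym le)) s

    induced-occurs : ∀ {pre q} → InducedAt pre q → OccursAt (F e) (Fpath (x ∷ xs)) q
    induced-occurs {q = q} (induced π rest _ split ends position)
      with prefix-Fpath-ends π rest split ends
    ... | P , eq = subst₂ (OccursAt (F e)) (sym Fpath≡) |P|≡q (OccursAt-++ P (F e) (frontTail rest))
      where
        Fpath≡ : Fpath (x ∷ xs) ≡ P ++ F e ++ frontTail rest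
        Fpath≡ = begin
          Fpath (x ∷ xs)                    ≡⟨ cong (Fpath ∘ (x ∷_)) split ⟩
          Fpath (x ∷ π ++ rest)             ≡⟨ Fpath-++ x π rest ⟩
          Fpath (x ∷ π) ++ frontTail rest   ≡⟨ cong (_++ frontTail rest) eq ⟩
          (P ++ F e) ++ frontTail rest      ≡⟨ List.++-assoc P (F e) (frontTail rest) ⟩
          P ++ F e ++ frontTail rest        ∎
          where open ≡-Reasoning
        |P|≡q : length P ≡ q
        |P|≡q = ℕ.+-cancelʳ-≡ (length (F e)) (length P) q
                  (trans (sym (List.length-++ P)) (trans (cong length (sym eq)) (sym position)))

    mutual
      induced-positions : ∀ pre rest → xs ≡ pre ++ rest →
        ∃ λ Q → length Q ≡ count e (lastFrom x pre ∷ rest) × AllPairs _<_ Q × All (InducedAt pre) Q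
      induced-positions pre rest split with lastFrom x pre ≟ᶠ e | induced-positions-after pre rest split
      ... | yes le | Q , len , sorted , ind , beyond =
        let q₀ , at , pos = induced-here pre rest split le in
        q₀ ∷ Q , cong suc len , beyond le pos ∷ sorted , at ∷ ind
      ... | no _   | Q , len , sorted , ind , _ = Q , len , sorted , ind

      induced-positions-after : ∀ pre rest → xs ≡ pre ++ rest →
        ∃ λ Q → length Q ≡ count e rest × AllPairs _<_ Q × All (InducedAt pre) Q ×
                (∀ {q₀} → lastFrom x pre ≡ e → q₀ + length (F e) ≡ length (Fpath (x ∷ pre)) → All (q₀ <_) Q)
      induced-positions-after pre []         _     = [] , refl , [] , [] , λ _ _ → []
      induced-positions-after pre (b ∷ rest) split
        with induced-positions (pre ∷ʳ b) rest (trans split (sym (List.∷ʳ-++ pre b rest)))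
      ... | Q , len , sorted , ind =
        Q , trans len (cong (λ y → count e (y ∷ rest)) (lastFrom-++ x pre (b ∷ []))) , sorted ,
        All.map induced-weaken ind , λ le pos → All.map (induced-beyond le pos) ind

    -- Condition (4) bounds the occurrences of F e by those of e, and distinct occurrences of e
    -- induce distinct occurrences of F e, so every occurrence of F e is induced.
    occurrence⇒induced : ∀ {q} → OccursAt (F e) (Fpath (x ∷ xs)) q → InducedAt [] q
    occurrence⇒induced {q} occ with induced-positions [] xs refl
    ... | Q , len , sorted , ind with q ∈? Q
    ...   | yes q∈Q = All.lookup ind q∈Q
    ...   | no  q∉Q = ⊥-elim (ℕ.<-irrefl refl (subst (suc (length Q) ≤_) (sym len)
                        (occurrences≤count e (x ∷ xs) _ (multiplicity (e ∷ []) (x ∷ xs) ([-] , se) symmetric-x∷xs _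
                          (insert q Q , length-insert q Q , AllPairs-insert q Q q∉Q sorted ,
                           subst (λ u → All (OccursAt u (Fpath (x ∷ xs))) (insert q Q)) (sym (List.++-identityʳ (F e)))
                             (All-insert q Q occ (All.map induced-occurs ind)))))))

    cycle-between : ∀ π σ rest → xs ≡ (π ++ σ) ++ rest → lastFrom x π ≡ e → lastFrom x (π ++ σ) ≡ e → Cycle e σ
    cycle-between π σ rest split ends₁ ends₂ =
      subst (λ y → Linked Step (y ∷ σ)) ends₁ (Linked-suffix x π σ (Linked-prefix x (π ++ σ) rest (along split))) ,
      trans (cong (λ y → lastFrom y σ) (sym ends₁)) (trans (sym (lastFrom-++ x π σ)) ends₂)

    -- σ is the part of the path between the occurrences of e inducing the two occurrences of F e.
    cycle-between-occurrences : ∀ {P V n} → 0 < n →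
      Fpath (x ∷ xs) ≡ P ++ F e ++ V → OccursAt (F e) (Fpath (x ∷ xs)) (length P + n) →
      ∃ λ σ → Cycle e σ × ∃ λ V′ → V ≡ frontTail σ ++ V′ × length (frontTail σ) ≡ n
    cycle-between-occurrences {P} {V} {n} n>0 Fpath≡ occ₂
      with occurrence⇒induced (subst (λ u → OccursAt (F e) u (length P)) (sym Fpath≡) (OccursAt-++ P (F e) V))
         | occurrence⇒induced occ₂
    ... | induced π₁ rest₁ _ split₁ ends₁ pos₁ | induced π₂ rest₂ _ split₂ ends₂ pos₂
      with ++-prefix-total π₁ rest₁ π₂ rest₂ (trans (sym split₁) split₂)
    ... | inj₂ (τ , refl) = ⊥-elim (ℕ.<-irrefl refl (begin-strict
      length P + n + length (F e)                         ≡⟨ pos₂ ⟩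
      length (Fpath (x ∷ π₂))                             ≤⟨ ℕ.m≤m+n _ _ ⟩
      length (Fpath (x ∷ π₂)) + length (frontTail τ)      ≡⟨ length-Fpath-++ x π₂ τ ⟨
      length (Fpath (x ∷ π₂ ++ τ))                        ≡⟨ pos₁ ⟨
      length P + length (F e)                             <⟨ ℕ.+-monoˡ-< (length (F e)) (ℕ.m<m+n (length P) n>0) ⟩
      length P + n + length (F e)                         ∎))
      where open ℕ.≤-Reasoning
    ... | inj₁ (σ , refl) =
      σ , cycle-between π₁ σ rest₂ split₂ ends₁ ends₂ ,
      frontTail rest₂ , sym (proj₂ (++-cancel-length (Fpath (x ∷ π₁)) _ _ _ (trans (sym pos₁) (sym (List.length-++ P))) Fpath-split)) ,
      ℕ.+-cancelˡ-≡ (length P + length (F e)) _ _ (begin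
        length P + length (F e) + length (frontTail σ)   ≡⟨ cong (_+ length (frontTail σ)) pos₁ ⟩
        length (Fpath (x ∷ π₁)) + length (frontTail σ)   ≡⟨ length-Fpath-++ x π₁ σ ⟨
        length (Fpath (x ∷ π₁ ++ σ))                     ≡⟨ pos₂ ⟨
        length P + n + length (F e)                      ≡⟨ xy∙z≈xz∙y (length P) n (length (F e)) ⟩
        length P + length (F e) + n                      ∎)
      where
        open ≡-Reasoning
        Fpath-split : Fpath (x ∷ π₁) ++ frontTail σ ++ frontTail rest₂ ≡ (P ++ F e) ++ V
        Fpath-split = begin
          Fpath (x ∷ π₁) ++ frontTail σ ++ frontTail rest₂   ≡⟨ List.++-assoc (Fpath (x ∷ π₁)) _ _ ⟨
          (Fpath (x ∷ π₁) ++ frontTail σ) ++ frontTail rest₂ ≡⟨ cong (_++ frontTail rest₂) (Fpath-++ x π₁ σ) ⟨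
          Fpath (x ∷ π₁ ++ σ) ++ frontTail rest₂             ≡⟨ Fpath-++ x (π₁ ++ σ) rest₂ ⟨
          Fpath (x ∷ (π₁ ++ σ) ++ rest₂)                     ≡⟨ cong (Fpath ∘ (x ∷_)) split₂ ⟨
          Fpath (x ∷ xs)                                     ≡⟨ Fpath≡ ⟩
          P ++ F e ++ V                                      ≡⟨ List.++-assoc P (F e) V ⟨
          (P ++ F e) ++ V                                    ∎

module PeriodicScheme {A : Set} {W : ℕ → A} {N : ℕ} (N>0 : 0 < N) (period : ∀ k → W (k + N) ≡ W k)
                      (recurrent : Recurrent W) {S : GraphWithWords A} (R : IsRauzyScheme W S) where
  open GraphWithWords S
  open IsRauzyScheme R
  open GraphLemmas S
  open RauzyScheme R
  open Segments W
  open PeriodicWord W N period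

  module LongSupportEdge {e} (se : SupportEdge e) (N≤ : N ≤ length (F e)) where

    L : ℕ
    L = length (F e)

    p : ℕ
    p = proj₁ (proj₁ (edgeWords e))

    F-at-p : segment p L ≡ F e
    F-at-p = trans (sym (window≡segment p L)) (proj₂ (proj₁ (edgeWords e)))

    first-letter-on-segment-path : ∀ {x xs g a w i n} → Symmetric (x ∷ xs) → Fpath (x ∷ xs) ≡ segment i n →
                     g ∈ x ∷ xs → src g ≡ tgt e → F g ≡ a ∷ w → a ≡ W (p + L)
    first-letter-on-segment-path {a = a} {w} {i} {n} sym-x∷xs Fpath≡ g∈ sg≡te Fg≡
      with Fpath-through-support se sym-x∷xs g∈ sg≡te
    ... | P , Q , Fpath≡′ with segment-++⁻ i n P (F e ++ a ∷ w ++ Q) segment≡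
      where
        segment≡ : segment i n ≡ P ++ F e ++ a ∷ w ++ Q
        segment≡ = trans (sym Fpath≡) (trans Fpath≡′ (cong (λ u → P ++ F e ++ u ++ Q) Fg≡))
    ... | _ , after-P with segment-++⁻ (i + length P) _ (F e) (a ∷ w ++ Q) after-P
    ... | F-at-q , a-after = begin
      a                           ≡⟨ List.∷-injectiveˡ a-after ⟨
      W (i + length P + L)        ≡⟨ letter-after (F e) p (i + length P) N>0 N≤ F-at-p F-at-q ⟩
      W (p + L)                   ∎
      where open ≡-Reasoning

    period-cycle : ∃ λ σ → Cycle e σ × frontTail σ ≡ segment (p + L) N
    period-cycle with covering U (p , trans (window≡segment p (length U)) (cong (segment p) (length-segment p (L + N))))
      where U = segment p (L + N)
    ... | x ∷ xs , sym-x∷xs , _ , occ with OccursAt⇒++ occ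
    ... | P , v , Fpath≡ , _
      with SupportOccurrences.cycle-between-occurrences se sym-x∷xs {P} N>0 first second
      where
        borders = segment-borders p (F e) F-at-p
        first : Fpath (x ∷ xs) ≡ P ++ F e ++ segment (p + L) N ++ v
        first = trans Fpath≡ (cong (P ++_) (trans (cong (_++ v) (proj₁ borders)) (List.++-assoc (F e) _ v)))
        second : OccursAt (F e) (Fpath (x ∷ xs)) (length P + N)
        second = subst₂ (OccursAt (F e)) (sym Fpath≡₂)
                   (trans (List.length-++ P) (cong (length P +_) (length-segment p N)))
                   (OccursAt-++ (P ++ segment p N) (F e) v)
          where
            open ≡-Reasoning
            Fpath≡₂ : Fpath (x ∷ xs) ≡ (P ++ segment p N) ++ F e ++ v
            Fpath≡₂ = begin
              Fpath (x ∷ xs)                 ≡⟨ Fpath≡ ⟩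
              P ++ segment p (L + N) ++ v    ≡⟨ cong (λ u → P ++ u ++ v) (proj₂ borders) ⟩
              P ++ (segment p N ++ F e) ++ v ≡⟨ cong (P ++_) (List.++-assoc (segment p N) (F e) v) ⟩
              P ++ segment p N ++ F e ++ v   ≡⟨ List.++-assoc P (segment p N) _ ⟨
              (P ++ segment p N) ++ F e ++ v ∎
    ... | σ , cycle , V′ , V≡ , |σ| =
      σ , cycle , proj₁ (++-cancel-length _ V′ _ v (trans |σ| (sym (length-segment (p + L) N))) (sym V≡))

    module CyclePowers {σ} (cycle : Cycle e σ) (frontTail-σ : frontTail σ ≡ segment (p + L) N) where

      power : ℕ → List (Fin nE)
      power j = concat (replicate j σ)

      symmetric-power : ∀ j → Symmetric (e ∷ power j)
      symmetric-power j with Cycle-replicate cycle j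
      ... | path , ends = symmetric path (proj₁ se) (subst (Distributing ∘ tgt) (sym ends) (proj₂ se))

      Fpath-power : ∀ j → Fpath (e ∷ power j) ≡ segment p (L + j * N)
      Fpath-power j = begin
        F e ++ frontTail (power j)                      ≡⟨ cong (F e ++_) (frontTail-replicate σ j) ⟩
        F e ++ concat (replicate j (frontTail σ))       ≡⟨ cong (λ u → F e ++ concat (replicate j u)) frontTail-σ ⟩
        F e ++ concat (replicate j (segment (p + L) N)) ≡⟨ cong₂ _++_ (sym F-at-p) (concat-replicate-segment (p + L) j) ⟩
        segment p L ++ segment (p + L) (j * N)          ≡⟨ segment-+ p L (j * N) ⟨
        segment p (L + j * N)                           ∎
        where open ≡-Reasoning

      -- The front words of the powers of σ exhaust W, so condition (7) puts every edge on one of them.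
      every-edge-on-power : ∀ g → ∃ λ j → g ∈ e ∷ power j
      every-edge-on-power g with edgeMarker g
      ... | u , u∈W , marks with recurrent u u∈W p
      ... | i , p≤i , u-at-i with ℕ.m≤n⇒∃[o]m+o≡n p≤i
      ... | d , refl = j , marks (e ∷ power j) (symmetric-power j)
                             (subst₂ Factor u-at-p+d (sym (Fpath-power j)) (segment-factor p d (length u) (L + j * N) bound))
        where
          instance _ = >-nonZero N>0
          j = d + length u
          u-at-p+d : segment (p + d) (length u) ≡ u
          u-at-p+d = trans (sym (window≡segment (p + d) (length u))) u-at-i
          bound : d + length u ≤ L + j * N
          bound = ℕ.≤-trans (ℕ.m≤m*n j N) (ℕ.m≤n+m (j * N) L)

      first-letter : ∀ {g a w} → src g ≡ tgt e → F g ≡ a ∷ w → a ≡ W (p + L)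
      first-letter {g} sg≡te Fg≡ with every-edge-on-power g
      ... | j , g∈ = first-letter-on-segment-path (symmetric-power j) (Fpath-power j) g∈ sg≡te Fg≡

      impossible : ⊥
      impossible with distributing-two-out (proj₂ se)
      ... | g₁ , g₂ , g₁≢g₂ , s₁ , s₂
        with frontFirst g₁ g₂ g₁≢g₂ (trans s₁ (sym s₂)) (subst Distributing (sym s₁) (proj₂ se))
      ... | a , b , _ , _ , F₁≡ , F₂≡ , a≢b = a≢b (trans (first-letter s₁ F₁≡) (sym (first-letter s₂ F₂≡)))

    impossible : ⊥
    impossible = CyclePowers.impossible (proj₁ (proj₂ period-cycle)) (proj₂ (proj₂ period-cycle))

  support-word-shorter-than-period : ∀ {e} → SupportEdge e → length (F e) < N
  support-word-shorter-than-period {e} se with N ℕ.≤? length (F e)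
  ... | yes N≤ = ⊥-elim (LongSupportEdge.impossible se N≤)
  ... | no  N≰ = ℕ.≰⇒> N≰

corollary7 : {A : Set} (W : ℕ → A) (N : ℕ) → Recurrent W → Periodic W N →
    (S : GraphWithWords A) → IsRauzyScheme W S →
    ∃ λ m → GraphWithWords.IsScale S m × m < N
corollary7 W N recurrent periodic S R with RauzyScheme.scale-attained R
... | e , se , scale = length (F e) , scale , support-word-shorter-than-period se
  where
    open GraphWithWords S using (F)
    open PeriodicScheme (proj₁ (proj₂ periodic)) (periodic⇒period W N periodic) recurrent R
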